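{- For every non-negative integer $n$, $$\sum_{k=0}^n\binom{2n+1}{n-k}\left[\binom{2n}{n-k}-\binom{2n}{n-k-1}\right]=\binom{2n}{n}^2.$$
   Context: Convention: $\binom{N}{k}=0$ whenever $k<0$ or $k>N$. -}

module Defs where

open import Data.Nat using (ℕ; zero; suc)
open import Data.Integer using (ℤ; +_; -[1+_]; _+_)
open import Data.Nat.Combinatorics using (_C_)

-- Binomial coefficient with integer lower index: (N choose k) = 0 for k < 0
-- (and for k > N, as already in the library's _C_).
binomℤ : ℕ → ℤ → ℕ
binomℤ N (+ k)      = N C k
binomℤ N -[1+ _ ]   = 0

sumTo : ℕ → (ℕ → ℤ) → ℤ
sumTo zero    f = f 0
sumTo (suc n) f = sumTo n f + f (suc n)

-- Pascal's rule turns each summand into a difference of squares,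
-- C(2n+1,j)(C(2n,j) − C(2n,j−1)) = C(2n,j)² − C(2n,j−1)², with j = n − k.
-- The sum over k = 0 … n telescopes to C(2n,n)² − C(2n,−1)² = C(2n,n)².
module Submission where

open import Defs
open import Data.Nat using (ℕ; zero; suc)
open import Data.Integer using (ℤ; +_; -[1+_]; _+_; _-_; _*_)
open import Data.Nat.Combinatorics using (_C_; nCk+nC[k+1]≡[n+1]C[k+1])
open import Relation.Binary.PropositionalEquality
open import Data.Integer.Tactic.RingSolver using (solve-∀)
import Data.Nat as N
import Data.Nat.Properties as NP
import Data.Integer.Properties as ZP

sumTo-cong : ∀ {f g : ℕ → ℤ} N → (∀ k → f k ≡ g k) → sumTo N f ≡ sumTo N g
sumTo-cong zero    f≗g = f≗g 0
sumTo-cong (suc N) f≗g = cong₂ _+_ (sumTo-cong N f≗g) (f≗g (suc N))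

sumTo-telescope : ∀ (f : ℕ → ℤ) N → sumTo N (λ k → f k - f (suc k)) ≡ f 0 - f (suc N)
sumTo-telescope f zero    = refl
sumTo-telescope f (suc N) = begin
  sumTo N (λ k → f k - f (suc k)) + (f (suc N) - f (suc (suc N)))
    ≡⟨ cong (_+ (f (suc N) - f (suc (suc N)))) (sumTo-telescope f N) ⟩
  f 0 - f (suc N) + (f (suc N) - f (suc (suc N)))
    ≡⟨ cancel (f 0) (f (suc N)) (f (suc (suc N))) ⟩
  f 0 - f (suc (suc N)) ∎
  where
  open ≡-Reasoning
  cancel : ∀ a b c → a - b + (b - c) ≡ a - c
  cancel = solve-∀

i-k-1≡i-[1+k] : ∀ i k → i - + k - + 1 ≡ i - + suc k
i-k-1≡i-[1+k] i k = trans (reassoc i (+ k) (+ 1)) (cong (λ t → i - + t) (NP.+-comm k 1))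
  where
  reassoc : ∀ a b c → a - b - c ≡ a - (b + c)
  reassoc = solve-∀

binomℤ-pascal : ∀ m x → + binomℤ (suc m) x ≡ + binomℤ m x + + binomℤ m (x - + 1)
binomℤ-pascal m (+ zero)  = refl
binomℤ-pascal m (+ suc k) =
  cong +_ (trans (sym (nCk+nC[k+1]≡[n+1]C[k+1] m k)) (NP.+-comm (m C k) _))
binomℤ-pascal m -[1+ k ]  = refl

binomℤ² : ℕ → ℤ → ℤ
binomℤ² m x = + binomℤ m x * + binomℤ m x

binomℤ-suc-*-difference : ∀ m x →
  + binomℤ (suc m) x * (+ binomℤ m x - + binomℤ m (x - + 1))
    ≡ binomℤ² m x - binomℤ² m (x - + 1)
binomℤ-suc-*-difference m x =
  trans (cong (_* (+ binomℤ m x - + binomℤ m (x - + 1))) (binomℤ-pascal m x))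
        (difference-of-squares (+ binomℤ m x) (+ binomℤ m (x - + 1)))
  where
  difference-of-squares : ∀ a b → (a + b) * (a - b) ≡ a * a - b * b
  difference-of-squares = solve-∀

lemma3p2 : ∀ (n : ℕ) →
    sumTo n (λ k → + binomℤ (2 Data.Nat.* n Data.Nat.+ 1) (+ n - + k)
                   * (+ binomℤ (2 Data.Nat.* n) (+ n - + k) - + binomℤ (2 Data.Nat.* n) (+ n - + k - + 1)))
      ≡ + ((2 Data.Nat.* n) C n) * + ((2 Data.Nat.* n) C n)
lemma3p2 n = begin
  sumTo n (λ k → + binomℤ (m N.+ 1) (+ n - + k)
                 * (+ binomℤ m (+ n - + k) - + binomℤ m (+ n - + k - + 1)))
    ≡⟨ sumTo-cong n summand≡difference ⟩
  sumTo n (λ k → f k - f (suc k))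
    ≡⟨ sumTo-telescope f n ⟩
  f 0 - f (suc n)
    ≡⟨ cong₂ (λ i j → binomℤ² m i - binomℤ² m j) (ZP.+-identityʳ (+ n)) n-[1+n]≡-1 ⟩
  binomℤ² m (+ n) - + 0
    ≡⟨ ZP.+-identityʳ _ ⟩
  binomℤ² m (+ n) ∎
  where
  open ≡-Reasoning
  m = 2 N.* n
  f : ℕ → ℤ
  f k = binomℤ² m (+ n - + k)
  summand≡difference : ∀ k →
    + binomℤ (m N.+ 1) (+ n - + k) * (+ binomℤ m (+ n - + k) - + binomℤ m (+ n - + k - + 1))
      ≡ f k - f (suc k)
  summand≡difference k rewrite NP.+-comm m 1 | sym (i-k-1≡i-[1+k] (+ n) k) =
    binomℤ-suc-*-difference m (+ n - + k)
  n-[1+n]≡-1 : + n - + suc n ≡ -[1+ 0 ]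
  n-[1+n]≡-1 = trans (sym (i-k-1≡i-[1+k] (+ n) n)) (cong (_- + 1) (ZP.+-inverseʳ (+ n)))
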